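{- Let $g,d$ be positive integers and $q=\min\{g,d\}$. Then $N_{g,d}=\sum_{n=1}^{q}N^{(n)}_{g,n}$.
   Context: A generalized numerical semigroup (GNS) in $\mathbb{N}^d$ is a submonoid $S$ of $(\mathbb{N}^d,+)$ with $\operatorname{H}(S)=\mathbb{N}^d\setminus S$ finite; $|\operatorname{H}(S)|$ is its genus; $\mathcal{S}_{g,d}$ is the set of GNSs in $\mathbb{N}^d$ of genus $g$. Two GNSs in $\mathbb{N}^d$ are isomorphic (equivalently, one is obtained from the other by a permutation of coordinates); $[S]_\simeq$ denotes the isomorphism class of $S$. $N_{g,d}=|\{[S]_\simeq\mid S\in\mathcal{S}_{g,d}\}|$. For $r\leq\min\{g,d\}$, $N^{(r)}_{g,d}$ is the number of classes $[S]_\simeq$ with $S\in\mathcal{S}_{g,d}$ and $\dim\mathrm{Span}_{\mathbb{R}}(\operatorname{H}(S))=r$, where $\mathrm{Span}_{\mathbb{R}}$ denotes the real linear span in $\mathbb{R}^d$. -}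

module Defs where

open import Data.Nat using (ℕ; zero; suc; _≤_; _⊓_)
open import Data.Integer using (ℤ; +_; _*_) renaming (_+_ to _+ℤ_)
open import Data.Fin using (Fin; zero; suc)
open import Data.Fin.Permutation using (Permutation′; _⟨$⟩ʳ_)
open import Data.Vec using (Vec; replicate; zipWith; lookup; tabulate)
open import Data.List using (List; length)
open import Data.List.Membership.Propositional using (_∈_; _∉_)
open import Data.List.Relation.Unary.Unique.Propositional using (Unique)
open import Data.Product using (Σ; ∃; _×_)
open import Function.Bundles using (_⇔_)
open import Relation.Binary.PropositionalEquality using (_≡_)

Pt : ℕ → Set
Pt d = Vec ℕ d

0ᵖ : ∀ {d} → Pt d
0ᵖ {d} = replicate d 0

_+ᵖ_ : ∀ {d} → Pt d → Pt d → Pt d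
_+ᵖ_ = zipWith Data.Nat._+_

-- H is the (finite) hole set of a GNS S = ℕ^d ∖ H of genus g:
-- H is a duplicate-free list of g points, and S is a submonoid of (ℕ^d,+).
record IsGNSHoles (g d : ℕ) (H : List (Pt d)) : Set where
  field
    distinct : Unique H
    genus    : length H ≡ g
    zero∈S   : 0ᵖ ∉ H
    closed   : ∀ x y → x ∉ H → y ∉ H → (x +ᵖ y) ∉ H

permute : ∀ {d} → Permutation′ d → Pt d → Pt d
permute σ x = tabulate (λ i → lookup x (σ ⟨$⟩ʳ i))

Iso : ∀ d → List (Pt d) → List (Pt d) → Set
Iso d H H′ = Σ (Permutation′ d) λ σ → ∀ x → (x ∈ H) ⇔ (permute σ x ∈ H′)

sumFin : ∀ {k} → (Fin k → ℤ) → ℤ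
sumFin {zero}  f = + 0
sumFin {suc k} f = f zero +ℤ sumFin (λ i → f (suc i))

-- linear independence (over ℝ; equivalently over ℤ for integer vectors)
LinIndep : ∀ {d k} → (Fin k → Pt d) → Set
LinIndep {d} {k} v =
  ∀ (c : Fin k → ℤ) →
    (∀ (j : Fin d) → sumFin (λ i → c i * (+ lookup (v i) j)) ≡ + 0) →
    ∀ i → c i ≡ + 0

-- dim Span_ℝ(H) = r : r is the maximal size of a linearly independent family from H
DimSpan : ∀ d → List (Pt d) → ℕ → Set
DimSpan d H r =
  (Σ (Fin r → Pt d) λ v → (∀ i → v i ∈ H) × LinIndep v)
  × (∀ k (v : Fin k → Pt d) → (∀ i → v i ∈ H) → LinIndep v → k ≤ r)

ClassCount : {A : Set} → (A → Set) → (A → A → Set) → ℕ → Set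
ClassCount {A} P _~_ n =
  Σ (Fin n → A) λ rep →
    (∀ i → P (rep i))
    × (∀ i j → rep i ~ rep j → i ≡ j)
    × (∀ a → P a → ∃ λ i → a ~ rep i)

-- A hole set H ⊆ ℕ^d only involves the coordinates on which some hole is non-zero. Permuting
-- these to the front and forgetting the others turns H into a hole set P ⊆ ℕ^n, of the same
-- genus, that uses every coordinate; padding with zeros goes back. Isomorphism classes match,
-- because an isomorphism carries the used coordinates of one hole set onto those of the other.
-- A hole set P ⊆ ℕ^n using every coordinate spans ℝ^n: for each i there is a hole with i-th
-- coordinate 1 all of whose other non-zero coordinates j have e_j ∈ P (obtained by repeatedly
-- splitting off unit vectors that are not holes), chosen to be e_i when e_i ∈ P, and these n holes
-- are linearly independent; so n ≤ g, and n ≥ 1 as g ≥ 1. Conversely, n independent holes use every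
-- coordinate. Hence the classes in ℕ^d correspond to the disjoint union over n ∈ [1, min(g, d)]
-- of the classes in ℕ^n whose holes span ℝ^n.

module Submission where

open import Defs
open import Data.Nat using (ℕ; suc; _≤_; _⊓_)
open import Data.List using (map; applyUpTo)
open import Data.Nat.ListAction using (sum)
open import Data.Product using (_×_)
open import Relation.Binary.PropositionalEquality using (_≡_)

open import Data.Nat as ℕ using (zero; _+_; _<_; z≤n; s≤s)
import Data.Nat.Properties as ℕ
import Data.Nat.Induction as ℕ
open import Data.Integer as ℤ using (ℤ; +_; _*_; -_; _-_) renaming (_+_ to _+ℤ_)
import Data.Integer.Properties as ℤ
open import Data.Integer.Tactic.RingSolver using (solve-∀)
open import Data.Fin as Fin using (Fin; zero; suc; toℕ; fromℕ<; inject≤; punchIn; punchOut; _↑ˡ_; _↑ʳ_)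
import Data.Fin.Properties as Fin
open import Data.Fin.Permutation as Perm using (Permutation′; _⟨$⟩ʳ_; _⟨$⟩ˡ_; inverseˡ; inverseʳ; flip; _∘ₚ_)
open import Data.List using (List; []; _∷_)
import Data.List.Properties as List
open import Data.List.Membership.Propositional using (_∈_; _∉_; find; lose)
import Data.List.Membership.Propositional.Properties as ∈
import Data.List.Relation.Unary.All as All
open import Data.List.Relation.Unary.Any as Any using (here; there; any?)
import Data.List.Relation.Unary.Any.Properties as Anyₚ
open import Data.List.Relation.Unary.AllPairs using (_∷_)
open import Data.List.Relation.Unary.Unique.Propositional using (Unique)
import Data.List.Relation.Unary.Unique.Propositional.Properties as Unique
open import Data.Vec using ([]; _∷_; lookup; tabulate; _[_]≔_; _[_]%=_) renaming (sum to weight)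
import Data.Vec.Properties as Vec
open import Data.Vec.Functional using (insertAt)
open import Data.Vec.Functional.Properties using (insertAt-lookup; insertAt-punchIn)
open import Data.Product using (Σ; ∃; _,_; proj₁; proj₂; uncurry)
open import Data.Sum using (_⊎_; inj₁; inj₂; [_,_]′)
open import Function.Base using (_∘_)
open import Function.Bundles using (_⇔_; mk⇔; Equivalence)
import Function.Properties.Equivalence as ⇔
open import Relation.Binary.Structures using (IsEquivalence)
open import Relation.Binary.PropositionalEquality
  using (_≢_; refl; sym; trans; cong; cong₂; subst; subst₂; module ≡-Reasoning)
open import Relation.Nullary using (¬_; Dec; yes; no; ¬?; _×-dec_; contradiction)
open import Relation.Nullary.Decidable using (decidable-stable; map′)
open import Relation.Unary using (Decidable; _∪_)
open import Induction.WellFounded using (Acc; acc)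
open import Level using (0ℓ)

open Equivalence using (to; from)

-- Counting equivalence classes

module _ {A : Set} {_≈_ : A → A → Set} (≈-equiv : IsEquivalence _≈_) where
  open IsEquivalence ≈-equiv renaming (sym to ≈-sym; trans to ≈-trans)

  ClassCount-≤ : ∀ {P : A → Set} {m n} → ClassCount P _≈_ m → ClassCount P _≈_ n → m ≤ n
  ClassCount-≤ {m = m} {n} (rep₁ , P-rep₁ , rep₁-injective , _) (rep₂ , _ , _ , cover₂) =
    Fin.injective⇒≤ {f = class} class-injective
    where
    class : Fin m → Fin n
    class i = proj₁ (cover₂ (rep₁ i) (P-rep₁ i))
    class-injective : ∀ {i j} → class i ≡ class j → i ≡ j
    class-injective {i} {j} class≡ = rep₁-injective i j (≈-trans (proj₂ (cover₂ (rep₁ i) (P-rep₁ i)))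
      (≈-sym (subst (λ k → rep₁ j ≈ rep₂ k) (sym class≡) (proj₂ (cover₂ (rep₁ j) (P-rep₁ j))))))

  ClassCount-unique : ∀ {P : A → Set} {m n} → ClassCount P _≈_ m → ClassCount P _≈_ n → m ≡ n
  ClassCount-unique ccₘ ccₙ = ℕ.≤-antisym (ClassCount-≤ ccₘ ccₙ) (ClassCount-≤ ccₙ ccₘ)

  ClassCount-∪ : ∀ {P Q : A → Set} {m n} → ClassCount P _≈_ m → ClassCount Q _≈_ n →
    (∀ {a b} → P a → Q b → ¬ a ≈ b) → ClassCount (P ∪ Q) _≈_ (m + n)
  ClassCount-∪ {P} {Q} {m} {n} (rep₁ , P-rep₁ , rep₁-injective , cover₁) (rep₂ , Q-rep₂ , rep₂-injective , cover₂)
    disjoint = rep , rep-∈ , rep-injective , cover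
    where
    rep : Fin (m + n) → A
    rep k = [ rep₁ , rep₂ ]′ (Fin.splitAt m k)
    rep-∈ : ∀ k → (P ∪ Q) (rep k)
    rep-∈ k with Fin.splitAt m k
    ... | inj₁ i = inj₁ (P-rep₁ i)
    ... | inj₂ j = inj₂ (Q-rep₂ j)
    rep-injective : ∀ k l → rep k ≈ rep l → k ≡ l
    rep-injective k l r with Fin.splitAt m k in k≡ | Fin.splitAt m l in l≡
    ... | inj₁ i | inj₁ i′ =
      trans (sym (Fin.splitAt⁻¹-↑ˡ k≡)) (trans (cong (_↑ˡ n) (rep₁-injective i i′ r)) (Fin.splitAt⁻¹-↑ˡ l≡))
    ... | inj₂ j | inj₂ j′ =
      trans (sym (Fin.splitAt⁻¹-↑ʳ k≡)) (trans (cong (m ↑ʳ_) (rep₂-injective j j′ r)) (Fin.splitAt⁻¹-↑ʳ l≡))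
    ... | inj₁ i | inj₂ j  = contradiction r (disjoint (P-rep₁ i) (Q-rep₂ j))
    ... | inj₂ j | inj₁ i  = contradiction (≈-sym r) (disjoint (P-rep₁ i) (Q-rep₂ j))
    cover : ∀ a → (P ∪ Q) a → ∃ λ k → a ≈ rep k
    cover a (inj₁ Pa) = let (i , a≈repᵢ) = cover₁ a Pa in
      i ↑ˡ n , subst (λ s → a ≈ [ rep₁ , rep₂ ]′ s) (sym (Fin.splitAt-↑ˡ m i n)) a≈repᵢ
    cover a (inj₂ Qa) = let (j , a≈repⱼ) = cover₂ a Qa in
      m ↑ʳ j , subst (λ s → a ≈ [ rep₁ , rep₂ ]′ s) (sym (Fin.splitAt-↑ʳ m n j)) a≈repⱼ

ClassCount-⇔ : ∀ {A : Set} {P Q : A → Set} {_≈_ : A → A → Set} {n} → (∀ a → P a ⇔ Q a) →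
  ClassCount P _≈_ n → ClassCount Q _≈_ n
ClassCount-⇔ P⇔Q (rep , P-rep , rep-injective , cover) =
  rep , (λ i → to (P⇔Q (rep i)) (P-rep i)) , rep-injective , λ a Qa → cover a (from (P⇔Q a) Qa)

ClassCount-∅ : ∀ {A : Set} {P : A → Set} {_≈_ : A → A → Set} → (∀ a → ¬ P a) → ClassCount P _≈_ 0
ClassCount-∅ ¬P = (λ ()) , (λ ()) , (λ ()) , λ a Pa → contradiction Pa (¬P a)

data Fibrewise {I : Set} {A : I → Set} (R : ∀ i → A i → A i → Set) : Σ I A → Σ I A → Set where
  fibrewise : ∀ {i x y} → R i x y → Fibrewise R (i , x) (i , y)

Fibrewise-isEquivalence : ∀ {I : Set} {A : I → Set} {R : ∀ i → A i → A i → Set} →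
  (∀ i → IsEquivalence (R i)) → IsEquivalence (Fibrewise R)
Fibrewise-isEquivalence R-equiv = record
  { refl  = fibrewise (IsEquivalence.refl (R-equiv _))
  ; sym   = λ { (fibrewise r) → fibrewise (IsEquivalence.sym (R-equiv _) r) }
  ; trans = λ { (fibrewise r) (fibrewise s) → fibrewise (IsEquivalence.trans (R-equiv _) r s) }
  }

Over : ∀ {I : Set} {A : I → Set} → (∀ i → A i → Set) → (I → Set) → Σ I A → Set
Over P S (i , a) = S i × P i a

module _ {I : Set} {A : I → Set} {P : ∀ i → A i → Set} {R : ∀ i → A i → A i → Set} where

  ClassCount-fibre : ∀ {i n} → ClassCount (P i) (R i) n → ClassCount (Over P (_≡ i)) (Fibrewise R) n
  ClassCount-fibre {i} (rep , P-rep , rep-injective , cover) =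
    (λ k → i , rep k) , (λ k → refl , P-rep k) , (λ { k l (fibrewise r) → rep-injective k l r }) ,
    λ { (i , a) (refl , Pa) → let (k , r) = cover a Pa in k , fibrewise r }

  ClassCount-Σ : (∀ i → IsEquivalence (R i)) → (count : I → ℕ) (is : List I) → Unique is →
    (∀ i → i ∈ is → ClassCount (P i) (R i) (count i)) →
    ClassCount (Over P (_∈ is)) (Fibrewise R) (sum (map count is))
  ClassCount-Σ R-equiv count [] _ _ = ClassCount-∅ {_≈_ = Fibrewise R} λ { (i , a) (() , _) }
  ClassCount-Σ R-equiv count (i ∷ is) (i∉is ∷ is-unique) cc = ClassCount-⇔ {_≈_ = Fibrewise R} split
    (ClassCount-∪ (Fibrewise-isEquivalence R-equiv) (ClassCount-fibre (cc i (here refl)))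
      (ClassCount-Σ R-equiv count is is-unique (λ j j∈is → cc j (there j∈is))) disjoint)
    where
    split : ∀ p → (Over P (_≡ i) ∪ Over P (_∈ is)) p ⇔ Over P (_∈ i ∷ is) p
    split (j , a) = mk⇔ (λ { (inj₁ (refl , Pa)) → here refl , Pa ; (inj₂ (j∈is , Pa)) → there j∈is , Pa })
                        (λ { (here refl , Pa) → inj₁ (refl , Pa) ; (there j∈is , Pa) → inj₂ (j∈is , Pa) })
    disjoint : ∀ {p q} → Over P (_≡ i) p → Over P (_∈ is) q → ¬ Fibrewise R p q
    disjoint (refl , _) (i∈is , _) (fibrewise _) = All.lookup i∉is i∈is refl

record ClassCorrespondence {A B : Set} (P : A → Set) (_~_ : A → A → Set) (Q : B → Set) (_≈_ : B → B → Set) : Set where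
  field
    f          : A → B
    preserves  : ∀ {a} → P a → Q (f a)
    f-cong     : ∀ {a a′} → P a → P a′ → a ~ a′ → f a ≈ f a′
    reflects   : ∀ {a a′} → P a → P a′ → f a ≈ f a′ → a ~ a′
    surjective : ∀ {b} → Q b → ∃ λ a → P a × f a ≈ b

ClassCount-correspondence : ∀ {A B : Set} {P : A → Set} {_~_ : A → A → Set} {Q : B → Set} {_≈_ : B → B → Set} →
  IsEquivalence _≈_ → ClassCorrespondence P _~_ Q _≈_ → ∀ {n} → ClassCount P _~_ n → ClassCount Q _≈_ n
ClassCount-correspondence ≈-equiv corr (rep , P-rep , rep-injective , cover) =
  f ∘ rep , preserves ∘ P-rep ,
  (λ i j r → rep-injective i j (reflects (P-rep i) (P-rep j) r)) ,
  λ b Qb → let (a , Pa , fa≈b) = surjective Qb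
               (i , a~repᵢ) = cover a Pa in
           i , IsEquivalence.trans ≈-equiv (IsEquivalence.sym ≈-equiv fa≈b) (f-cong Pa (P-rep i) a~repᵢ)
  where open ClassCorrespondence corr

-- Integer linear algebra

lincomb : ∀ {k n} → (Fin k → ℤ) → (Fin k → Fin n → ℤ) → Fin n → ℤ
lincomb c w j = sumFin (λ i → c i * w i j)

sumFin-cong : ∀ {k} {f g : Fin k → ℤ} → (∀ i → f i ≡ g i) → sumFin f ≡ sumFin g
sumFin-cong {zero}  f≗g = refl
sumFin-cong {suc k} f≗g = cong₂ _+ℤ_ (f≗g zero) (sumFin-cong (f≗g ∘ suc))

sumFin-zero : ∀ {k} (f : Fin k → ℤ) → (∀ i → f i ≡ + 0) → sumFin f ≡ + 0
sumFin-zero {zero}  f f≗0 = refl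
sumFin-zero {suc k} f f≗0 = cong₂ _+ℤ_ (f≗0 zero) (sumFin-zero (λ i → f (suc i)) (λ i → f≗0 (suc i)))

sumFin-punchIn : ∀ {k} (f : Fin (suc k) → ℤ) p → sumFin f ≡ f p +ℤ sumFin (λ i → f (punchIn p i))
sumFin-punchIn f zero = refl
sumFin-punchIn {suc k} f (suc p) = begin
  f zero +ℤ sumFin (λ i → f (suc i))
    ≡⟨ cong (f zero +ℤ_) (sumFin-punchIn (λ i → f (suc i)) p) ⟩
  f zero +ℤ (f (suc p) +ℤ rest)
    ≡⟨ exchange (f zero) (f (suc p)) rest ⟩
  f (suc p) +ℤ (f zero +ℤ rest) ∎
  where
  open ≡-Reasoning
  rest = sumFin (λ i → f (suc (punchIn p i)))
  exchange : ∀ a b c → a +ℤ (b +ℤ c) ≡ b +ℤ (a +ℤ c)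
  exchange = solve-∀

sumFin-single : ∀ {k} (f : Fin k → ℤ) j → (∀ i → i ≢ j → f i ≡ + 0) → sumFin f ≡ f j
sumFin-single {suc k} f j others = begin
  sumFin f                                     ≡⟨ sumFin-punchIn f j ⟩
  f j +ℤ sumFin (λ i → f (punchIn j i))        ≡⟨ cong (f j +ℤ_) (sumFin-zero _ λ i → others _ (Fin.punchInᵢ≢i j i)) ⟩
  f j +ℤ + 0                                   ≡⟨ ℤ.+-identityʳ (f j) ⟩
  f j                                          ∎
  where open ≡-Reasoning

sumFin-eliminate : ∀ {k} (c b x : Fin k → ℤ) a y →
  sumFin (λ i → (a * c i) * x i) - sumFin (λ i → c i * b i) * y ≡ sumFin (λ i → c i * (a * x i - b i * y))
sumFin-eliminate {zero}  c b x a y = refl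
sumFin-eliminate {suc k} c b x a y = begin
  ((a * c zero) * x zero +ℤ S) - (c zero * b zero +ℤ T) * y
    ≡⟨ regroup (c zero) (b zero) (x zero) a y S T ⟩
  c zero * (a * x zero - b zero * y) +ℤ (S - T * y)
    ≡⟨ cong (c zero * (a * x zero - b zero * y) +ℤ_) (sumFin-eliminate (c ∘ suc) (b ∘ suc) (x ∘ suc) a y) ⟩
  c zero * (a * x zero - b zero * y) +ℤ sumFin (λ i → c (suc i) * (a * x (suc i) - b (suc i) * y)) ∎
  where
  open ≡-Reasoning
  S = sumFin (λ i → (a * c (suc i)) * x (suc i))
  T = sumFin (λ i → c (suc i) * b (suc i))
  regroup : ∀ c₀ b₀ x₀ a y S T → ((a * c₀) * x₀ +ℤ S) - (c₀ * b₀ +ℤ T) * y ≡ c₀ * (a * x₀ - b₀ * y) +ℤ (S - T * y)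
  regroup = solve-∀

lincomb-zeroColumn : ∀ {k n} c (w : Fin k → Fin n → ℤ) j → (∀ i → w i j ≡ + 0) → lincomb c w j ≡ + 0
lincomb-zeroColumn c w j column≡0 = sumFin-zero _ λ i → trans (cong (c i *_) (column≡0 i)) (ℤ.*-zeroʳ (c i))

LinIndepℤ : ∀ {k n} → (Fin k → Fin n → ℤ) → Set
LinIndepℤ w = ∀ c → (∀ j → lincomb c w j ≡ + 0) → ∀ i → c i ≡ + 0

record LinDepℤ {k n} (w : Fin k → Fin n → ℤ) : Set where
  constructor linDep
  field
    coeff         : Fin k → ℤ
    combination≡0 : ∀ j → lincomb coeff w j ≡ + 0
    witness       : Fin k
    witness≢0     : coeff witness ≢ + 0

linDep-dropZeroColumn : ∀ {k n} (w : Fin k → Fin (suc n) → ℤ) → (∀ i → w i zero ≡ + 0) →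
  LinDepℤ (λ i j → w i (suc j)) → LinDepℤ w
linDep-dropZeroColumn w column≡0 (linDep c comb≡0 i c≢0) = linDep c combination≡0 i c≢0
  where
  combination≡0 : ∀ j → lincomb c w j ≡ + 0
  combination≡0 zero    = lincomb-zeroColumn c w zero column≡0
  combination≡0 (suc j) = comb≡0 j

-- One step of Gaussian elimination: the pivot row p clears the first column.
linDep-pivot : ∀ {k n} (w : Fin (suc k) → Fin (suc n) → ℤ) p → w p zero ≢ + 0 →
  LinDepℤ (λ i j → w p zero * w (punchIn p i) (suc j) - w (punchIn p i) zero * w p (suc j)) →
  LinDepℤ w
linDep-pivot {k} w p a≢0 (linDep c′ comb′≡0 i₀ c′≢0) = linDep c combination≡0 (punchIn p i₀) c≢0
  where
  a = w p zero
  b : Fin k → ℤ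
  b i = w (punchIn p i) zero
  B = sumFin (λ i → c′ i * b i)
  c = insertAt (λ i → a * c′ i) p (- B)

  eliminated : ∀ j → lincomb c w j ≡ sumFin (λ i → c′ i * (a * w (punchIn p i) j - b i * w p j))
  eliminated j = begin
    lincomb c w j
      ≡⟨ sumFin-punchIn (λ i → c i * w i j) p ⟩
    c p * w p j +ℤ sumFin (λ i → c (punchIn p i) * w (punchIn p i) j)
      ≡⟨ cong₂ _+ℤ_ (cong (_* w p j) (insertAt-lookup _ p (- B)))
                    (sumFin-cong λ i → cong (_* w (punchIn p i) j) (insertAt-punchIn _ p (- B) i)) ⟩
    - B * w p j +ℤ sumFin (λ i → (a * c′ i) * w (punchIn p i) j)
      ≡⟨ swap B (w p j) _ ⟩
    sumFin (λ i → (a * c′ i) * w (punchIn p i) j) - B * w p j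
      ≡⟨ sumFin-eliminate c′ b (λ i → w (punchIn p i) j) a (w p j) ⟩
    sumFin (λ i → c′ i * (a * w (punchIn p i) j - b i * w p j)) ∎
    where
    open ≡-Reasoning
    swap : ∀ B y v → - B * y +ℤ v ≡ v - B * y
    swap = solve-∀

  combination≡0 : ∀ j → lincomb c w j ≡ + 0
  combination≡0 zero    = trans (eliminated zero) (sumFin-zero _ λ i → cancel (c′ i) a (b i))
    where
    cancel : ∀ x a b → x * (a * b - b * a) ≡ + 0
    cancel = solve-∀
  combination≡0 (suc j) = trans (eliminated (suc j)) (comb′≡0 j)

  c≢0 : c (punchIn p i₀) ≢ + 0
  c≢0 c≡0 with ℤ.i*j≡0⇒i≡0∨j≡0 a (trans (sym (insertAt-punchIn _ p (- B) i₀)) c≡0)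
  ... | inj₁ a≡0  = a≢0 a≡0
  ... | inj₂ c′≡0 = c′≢0 c′≡0

linearDependence : ∀ {n k} → n < k → (w : Fin k → Fin n → ℤ) → LinDepℤ w
linearDependence {zero}  {suc k} _ w = linDep (λ _ → + 1) (λ ()) zero (λ ())
linearDependence {suc n} {suc k} (s≤s n<k) w with Fin.any? (λ p → ¬? (w p zero ℤ.≟ + 0))
... | yes (p , a≢0) = linDep-pivot w p a≢0 (linearDependence n<k _)
... | no none       = linDep-dropZeroColumn w column≡0 (linearDependence (ℕ.m<n⇒m<1+n n<k) _)
  where
  column≡0 : ∀ i → w i zero ≡ + 0
  column≡0 i = decidable-stable (w i zero ℤ.≟ + 0) (λ w≢0 → none (i , w≢0))

linIndep⇒≤ : ∀ {k n} (w : Fin k → Fin n → ℤ) → LinIndepℤ w → k ≤ n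
linIndep⇒≤ {k} {n} w indep with k ℕ.≤? n
... | yes k≤n = k≤n
... | no  k≰n = contradiction (indep coeff combination≡0 witness) witness≢0
  where open LinDepℤ (linearDependence (ℕ.≰⇒> k≰n) w)

linIndep-dropColumn : ∀ {k n} (w : Fin k → Fin (suc n) → ℤ) t → (∀ i → w i t ≡ + 0) →
  LinIndepℤ w → LinIndepℤ (λ i s → w i (punchIn t s))
linIndep-dropColumn w t column≡0 indep c comb≡0 = indep c λ j → at j (t Fin.≟ j)
  where
  at : ∀ j → Dec (t ≡ j) → lincomb c w j ≡ + 0
  at j (yes refl) = lincomb-zeroColumn c w t column≡0
  at j (no t≢j)   = subst (λ j → lincomb c w j ≡ + 0) (Fin.punchIn-punchOut t≢j) (comb≡0 (punchOut t≢j))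

-- Points and permutations of coordinates

lookup-ext : ∀ {d} {x y : Pt d} → (∀ i → lookup x i ≡ lookup y i) → x ≡ y
lookup-ext {x = x} {y} x≗y =
  trans (sym (Vec.tabulate∘lookup x)) (trans (Vec.tabulate-cong x≗y) (Vec.tabulate∘lookup y))

lookup-+ᵖ : ∀ {d} (x y : Pt d) i → lookup (x +ᵖ y) i ≡ lookup x i + lookup y i
lookup-+ᵖ x y i = Vec.lookup-zipWith _ i x y

lookup-0ᵖ : ∀ {d} i → lookup (0ᵖ {d}) i ≡ 0
lookup-0ᵖ i = Vec.lookup-replicate i 0

lookup-permute : ∀ {d} (σ : Permutation′ d) x i → lookup (permute σ x) i ≡ lookup x (σ ⟨$⟩ʳ i)
lookup-permute σ x i = Vec.lookup∘tabulate _ i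

module _ {d : ℕ} where

  permute-id : ∀ (x : Pt d) → permute Perm.id x ≡ x
  permute-id x = lookup-ext (lookup-permute Perm.id x)

  permute-∘ₚ : ∀ (σ τ : Permutation′ d) x → permute τ (permute σ x) ≡ permute (τ ∘ₚ σ) x
  permute-∘ₚ σ τ x = lookup-ext λ i → trans (lookup-permute τ (permute σ x) i)
    (trans (lookup-permute σ x (τ ⟨$⟩ʳ i)) (sym (lookup-permute (τ ∘ₚ σ) x i)))

  permute-inverseˡ : ∀ (σ : Permutation′ d) x → permute (flip σ) (permute σ x) ≡ x
  permute-inverseˡ σ x = lookup-ext λ i → trans (lookup-permute (flip σ) (permute σ x) i)
    (trans (lookup-permute σ x _) (cong (lookup x) (inverseʳ σ)))

  permute-inverseʳ : ∀ (σ : Permutation′ d) x → permute σ (permute (flip σ) x) ≡ x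
  permute-inverseʳ σ x = lookup-ext λ i → trans (lookup-permute σ (permute (flip σ) x) i)
    (trans (lookup-permute (flip σ) x _) (cong (lookup x) (inverseˡ σ)))

  permute-injective : ∀ (σ : Permutation′ d) {x y} → permute σ x ≡ permute σ y → x ≡ y
  permute-injective σ {x} {y} eq =
    trans (sym (permute-inverseˡ σ x)) (trans (cong (permute (flip σ)) eq) (permute-inverseˡ σ y))

  permute-+ᵖ : ∀ (σ : Permutation′ d) x y → permute σ (x +ᵖ y) ≡ permute σ x +ᵖ permute σ y
  permute-+ᵖ σ x y = lookup-ext λ i → begin
    lookup (permute σ (x +ᵖ y)) i
      ≡⟨ lookup-permute σ (x +ᵖ y) i ⟩
    lookup (x +ᵖ y) (σ ⟨$⟩ʳ i)
      ≡⟨ lookup-+ᵖ x y _ ⟩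
    lookup x (σ ⟨$⟩ʳ i) + lookup y (σ ⟨$⟩ʳ i)
      ≡⟨ sym (cong₂ _+_ (lookup-permute σ x i) (lookup-permute σ y i)) ⟩
    lookup (permute σ x) i + lookup (permute σ y) i
      ≡⟨ sym (lookup-+ᵖ (permute σ x) (permute σ y) i) ⟩
    lookup (permute σ x +ᵖ permute σ y) i ∎
    where open ≡-Reasoning

  permute-0ᵖ : ∀ (σ : Permutation′ d) → permute σ 0ᵖ ≡ 0ᵖ
  permute-0ᵖ σ = lookup-ext λ i →
    trans (lookup-permute σ 0ᵖ i) (trans (lookup-0ᵖ {d} (σ ⟨$⟩ʳ i)) (sym (lookup-0ᵖ {d} i)))

_≅[_]_ : ∀ {d} → List (Pt d) → Permutation′ d → List (Pt d) → Set
H ≅[ σ ] K = ∀ x → (x ∈ H) ⇔ (permute σ x ∈ K)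

module _ {d : ℕ} where

  Iso-refl : ∀ {H} → Iso d H H
  Iso-refl {H} = Perm.id , λ x → subst (λ y → (x ∈ H) ⇔ (y ∈ H)) (sym (permute-id x)) ⇔.refl

  Iso-sym : ∀ {H K} → Iso d H K → Iso d K H
  Iso-sym {H} {K} (σ , H≅K) = flip σ , λ x → ⇔.sym
    (subst (λ y → (permute (flip σ) x ∈ H) ⇔ (y ∈ K)) (permute-inverseʳ σ x) (H≅K (permute (flip σ) x)))

  Iso-trans : ∀ {H K M} → Iso d H K → Iso d K M → Iso d H M
  Iso-trans {H} {M = M} (σ , H≅K) (τ , K≅M) = τ ∘ₚ σ , λ x →
    subst (λ y → (x ∈ H) ⇔ (y ∈ M)) (permute-∘ₚ σ τ x) (⇔.trans (H≅K x) (K≅M (permute σ x)))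

  Iso-isEquivalence : IsEquivalence (Iso d)
  Iso-isEquivalence = record { refl = Iso-refl ; sym = Iso-sym ; trans = Iso-trans }

  ≅-map : ∀ (σ : Permutation′ d) H → H ≅[ σ ] map (permute σ) H
  ≅-map σ H x = mk⇔ (∈.∈-map⁺ (permute σ)) λ σx∈ →
    let (y , y∈ , σx≡σy) = ∈.∈-map⁻ (permute σ) σx∈ in subst (_∈ H) (sym (permute-injective σ σx≡σy)) y∈

⟨$⟩ʳ-injective : ∀ {d} (σ : Permutation′ d) {i j} → σ ⟨$⟩ʳ i ≡ σ ⟨$⟩ʳ j → i ≡ j
⟨$⟩ʳ-injective σ σi≡σj = trans (sym (inverseˡ σ)) (trans (cong (σ ⟨$⟩ˡ_) σi≡σj) (inverseˡ σ))

-- Supports and hole sets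

InSupport : ∀ {d} → List (Pt d) → Fin d → Set
InSupport H i = ∃ λ h → h ∈ H × lookup h i ≢ 0

InSupport? : ∀ {d} (H : List (Pt d)) i → Dec (InSupport H i)
InSupport? H i = map′ find (λ (h , h∈H , hᵢ≢0) → lose h∈H hᵢ≢0) (any? (λ h → ¬? (lookup h i ℕ.≟ 0)) H)

FullSupport : ∀ {d} → List (Pt d) → Set
FullSupport H = ∀ i → InSupport H i

InSupport-≅ : ∀ {d} {H K : List (Pt d)} σ → H ≅[ σ ] K → ∀ i → InSupport K i ⇔ InSupport H (σ ⟨$⟩ʳ i)
InSupport-≅ {H = H} {K} σ H≅K i = mk⇔
  (λ (k , k∈K , kᵢ≢0) → permute (flip σ) k
     , from (H≅K _) (subst (_∈ K) (sym (permute-inverseʳ σ k)) k∈K)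
     , λ k′≡0 → kᵢ≢0 (trans (sym (trans (lookup-permute (flip σ) k _) (cong (lookup k) (inverseˡ σ)))) k′≡0))
  (λ (h , h∈H , hσᵢ≢0) → permute σ h , to (H≅K h) h∈H
     , λ σh≡0 → hσᵢ≢0 (trans (sym (lookup-permute σ h i)) σh≡0))

dimSpan⇒fullSupport : ∀ {n} {P : List (Pt n)} → DimSpan n P n → FullSupport P
dimSpan⇒fullSupport {suc n} {P} ((v , v∈P , indep) , _) t = decidable-stable (InSupport? P t) λ t∉supp →
  ℕ.<-irrefl refl (linIndep⇒≤ (λ i s → + lookup (v i) (punchIn t s))
    (linIndep-dropColumn (λ i j → + lookup (v i) j) t (λ i → cong +_ (vᵢₜ≡0 t∉supp i)) indep))
  where
  vᵢₜ≡0 : ¬ InSupport P t → ∀ i → lookup (v i) t ≡ 0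
  vᵢₜ≡0 t∉supp i = decidable-stable (lookup (v i) t ℕ.≟ 0) λ vᵢₜ≢0 → t∉supp (v i , v∈P i , vᵢₜ≢0)

IsGNSHoles-transport : ∀ {g a b} {H : List (Pt a)} (f : Pt a → Pt b) (h : Pt b → Pt a) →
  (∀ x → x ∈ H → h (f x) ≡ x) →
  (∀ x y → (x +ᵖ y) ∈ map f H → f (h x) ≡ x × f (h y) ≡ y) →
  (∀ x y → h (x +ᵖ y) ≡ h x +ᵖ h y) → h 0ᵖ ≡ 0ᵖ →
  IsGNSHoles g a H → IsGNSHoles g b (map f H)
IsGNSHoles-transport {H = H} f h retract summands-in-image h-+ᵖ h-0ᵖ gns = record
  { distinct = Unique.map⁻ (subst Unique (sym h∘f≡id) G.distinct)
  ; genus    = trans (List.length-map f H) G.genus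
  ; zero∈S   = λ 0∈fH → G.zero∈S (subst (_∈ H) h-0ᵖ (h∈H 0∈fH))
  ; closed   = λ x y x∉fH y∉fH x+y∈fH →
      let (fhx≡x , fhy≡y) = summands-in-image x y x+y∈fH in
      G.closed (h x) (h y)
        (λ hx∈H → x∉fH (subst (_∈ map f H) fhx≡x (∈.∈-map⁺ f hx∈H)))
        (λ hy∈H → y∉fH (subst (_∈ map f H) fhy≡y (∈.∈-map⁺ f hy∈H)))
        (subst (_∈ H) (h-+ᵖ x y) (h∈H x+y∈fH))
  }
  where
  module G = IsGNSHoles gns
  h∘f≡id : map h (map f H) ≡ H
  h∘f≡id = trans (sym (List.map-∘ H)) (List.map-id-local (All.tabulate λ {x} → retract x))
  h∈H : ∀ {y} → y ∈ map f H → h y ∈ H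
  h∈H y∈fH = let (x , x∈H , y≡fx) = ∈.∈-map⁻ f y∈fH in
    subst (_∈ H) (sym (trans (cong h y≡fx) (retract x x∈H))) x∈H

IsGNSHoles-permute : ∀ {g d} {H : List (Pt d)} (σ : Permutation′ d) →
  IsGNSHoles g d H → IsGNSHoles g d (map (permute σ) H)
IsGNSHoles-permute σ = IsGNSHoles-transport (permute σ) (permute (flip σ))
  (λ x _ → permute-inverseˡ σ x) (λ x y _ → permute-inverseʳ σ x , permute-inverseʳ σ y)
  (permute-+ᵖ (flip σ)) (permute-0ᵖ (flip σ))

IsGNSHoles-dim>0 : ∀ {g n} {H : List (Pt n)} → 1 ≤ g → IsGNSHoles g n H → 1 ≤ n
IsGNSHoles-dim>0 {n = suc n}              _   _   = s≤s z≤n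
IsGNSHoles-dim>0 {n = zero} {H = []}     1≤g gns = contradiction (sym (IsGNSHoles.genus gns)) (ℕ.n>0⇒n≢0 1≤g)
IsGNSHoles-dim>0 {n = zero} {H = [] ∷ _} _   gns = contradiction (here refl) (IsGNSHoles.zero∈S gns)

-- Unit holes

𝕖 : ∀ {n} → Fin n → Pt n
𝕖 j = 0ᵖ [ j ]≔ 1

lookup-𝕖-self : ∀ {n} (j : Fin n) → lookup (𝕖 j) j ≡ 1
lookup-𝕖-self j = Vec.lookup∘update j 0ᵖ 1

lookup-𝕖-other : ∀ {n} {i j : Fin n} → i ≢ j → lookup (𝕖 j) i ≡ 0
lookup-𝕖-other {i = i} i≢j = trans (Vec.lookup∘update′ i≢j 0ᵖ 1) (lookup-0ᵖ i)

decrement : ∀ {n} → Pt n → Fin n → Pt n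
decrement h j = h [ j ]%= ℕ.pred

lookup-decrement-other : ∀ {n} (h : Pt n) {i j} → i ≢ j → lookup (decrement h j) i ≡ lookup h i
lookup-decrement-other h {i} {j} i≢j = Vec.lookup∘updateAt′ i j i≢j h

𝕖+decrement : ∀ {n} (h : Pt n) j → lookup h j ≢ 0 → 𝕖 j +ᵖ decrement h j ≡ h
𝕖+decrement h j hⱼ≢0 = lookup-ext λ i → trans (lookup-+ᵖ (𝕖 j) _ i) (at i (i Fin.≟ j))
  where
  at : ∀ i → Dec (i ≡ j) → lookup (𝕖 j) i + lookup (decrement h j) i ≡ lookup h i
  at i (yes refl) = trans (cong₂ _+_ (lookup-𝕖-self j) (Vec.lookup∘updateAt j h)) (ℕ.suc-pred _ ⦃ ℕ.≢-nonZero hⱼ≢0 ⦄)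
  at i (no i≢j)   = cong₂ _+_ (lookup-𝕖-other i≢j) (lookup-decrement-other h i≢j)

weight-decrement : ∀ {n} (h : Pt n) j → lookup h j ≢ 0 → weight (decrement h j) < weight h
weight-decrement (zero  ∷ h) zero    0≢0   = contradiction refl 0≢0
weight-decrement (suc x ∷ h) zero    _     = ℕ.n<1+n (x + weight h)
weight-decrement (x     ∷ h) (suc j) hⱼ≢0 = ℕ.+-monoʳ-< x (weight-decrement h j hⱼ≢0)

module UnitHoles {g n} {P : List (Pt n)} (gns : IsGNSHoles g n P) where
  open IsGNSHoles gns
  open import Data.List.Membership.DecPropositional (Vec.≡-dec {n = n} ℕ._≟_) using (_∈?_)

  hole-split : ∀ x y → (x +ᵖ y) ∈ P → x ∉ P → y ∈ P
  hole-split x y x+y∈P x∉P = decidable-stable (y ∈? P) λ y∉P → closed x y x∉P y∉P x+y∈P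

  hole-decrement : ∀ h j → h ∈ P → lookup h j ≢ 0 → 𝕖 j ∉ P → decrement h j ∈ P
  hole-decrement h j h∈P hⱼ≢0 = hole-split (𝕖 j) _ (subst (_∈ P) (sym (𝕖+decrement h j hⱼ≢0)) h∈P)

  record UnitHole (i : Fin n) (v : Pt n) : Set where
    field
      hole      : v ∈ P
      unit      : lookup v i ≡ 1
      others    : ∀ j → j ≢ i → lookup v j ≢ 0 → 𝕖 j ∈ P
      canonical : 𝕖 i ∈ P → v ≡ 𝕖 i

  -- If h = 𝕖 j + h′ is a hole and 𝕖 j is not, then h′ is a hole. So the coordinates j ≢ i of h
  -- with 𝕖 j ∉ P, and then its i-th coordinate, can be decreased until h is a unit hole.
  descend : ∀ i → 𝕖 i ∉ P → ∀ h → Acc _<_ (weight h) → h ∈ P → lookup h i ≢ 0 → ∃ (UnitHole i)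
  descend i eᵢ∉P h (acc smaller) h∈P hᵢ≢0
    with Fin.any? (λ j → ¬? (j Fin.≟ i) ×-dec ¬? (lookup h j ℕ.≟ 0) ×-dec ¬? (𝕖 j ∈? P)) | lookup h i ℕ.≟ 1
  ... | yes (j , j≢i , hⱼ≢0 , eⱼ∉P) | _ =
    descend i eᵢ∉P (decrement h j) (smaller (weight-decrement h j hⱼ≢0)) (hole-decrement h j h∈P hⱼ≢0 eⱼ∉P)
      (λ h′ᵢ≡0 → hᵢ≢0 (trans (sym (lookup-decrement-other h (j≢i ∘ sym))) h′ᵢ≡0))
  ... | no unblocked | yes hᵢ≡1 = h , record
    { hole      = h∈P
    ; unit      = hᵢ≡1
    ; others    = λ j j≢i hⱼ≢0 → decidable-stable (𝕖 j ∈? P) λ eⱼ∉P → unblocked (j , j≢i , hⱼ≢0 , eⱼ∉P)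
    ; canonical = λ eᵢ∈P → contradiction eᵢ∈P eᵢ∉P
    }
  ... | no _ | no hᵢ≢1 =
    descend i eᵢ∉P (decrement h i) (smaller (weight-decrement h i hᵢ≢0)) (hole-decrement h i h∈P hᵢ≢0 eᵢ∉P)
      (λ h′ᵢ≡0 → hᵢ≢1 (trans (sym (ℕ.suc-pred _ ⦃ ℕ.≢-nonZero hᵢ≢0 ⦄))
                               (cong suc (trans (sym (Vec.lookup∘updateAt i h)) h′ᵢ≡0))))

  unitHole : FullSupport P → ∀ i → ∃ (UnitHole i)
  unitHole full i with 𝕖 i ∈? P
  ... | yes eᵢ∈P = 𝕖 i , record
    { hole      = eᵢ∈P
    ; unit      = lookup-𝕖-self i
    ; others    = λ j j≢i eᵢⱼ≢0 → contradiction (lookup-𝕖-other j≢i) eᵢⱼ≢0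
    ; canonical = λ _ → refl
    }
  ... | no eᵢ∉P = let (h , h∈P , hᵢ≢0) = full i in descend i eᵢ∉P h (ℕ.<-wellFounded _) h∈P hᵢ≢0

  module _ (full : FullSupport P) where

    v : Fin n → Pt n
    v i = proj₁ (unitHole full i)

    open module UnitHoleOf (i : Fin n) = UnitHole (proj₂ (unitHole full i))

    v-injective : ∀ {i j} → v i ≡ v j → i ≡ j
    v-injective {i} {j} vᵢ≡vⱼ = decidable-stable (i Fin.≟ j) λ i≢j →
      let vⱼᵢ≡1 : lookup (v j) i ≡ 1
          vⱼᵢ≡1 = trans (cong (λ x → lookup x i) (sym vᵢ≡vⱼ)) (unit i)
          vⱼ≡eᵢ : v j ≡ 𝕖 i
          vⱼ≡eᵢ = trans (sym vᵢ≡vⱼ) (canonical i (others j i i≢j λ vⱼᵢ≡0 → ℕ.1+n≢0 (trans (sym vⱼᵢ≡1) vⱼᵢ≡0)))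
      in ℕ.1+n≢0 (trans (sym (unit j)) (trans (cong (λ x → lookup x j) vⱼ≡eᵢ) (lookup-𝕖-other (i≢j ∘ sym))))

    v-linIndep : LinIndep v
    v-linIndep c comb≡0 = all-zero
      where
      term≡0 : ∀ i j → lookup (v i) j ≡ 0 → c i * + lookup (v i) j ≡ + 0
      term≡0 i j vᵢⱼ≡0 = trans (cong (λ m → c i * + m) vᵢⱼ≡0) (ℤ.*-zeroʳ (c i))
      isolated : ∀ j → (∀ i → i ≢ j → c i * + lookup (v i) j ≡ + 0) → c j ≡ + 0
      isolated j others≡0 = begin
        c j                                  ≡⟨ sym (ℤ.*-identityʳ (c j)) ⟩
        c j * + 1                            ≡⟨ cong (λ m → c j * + m) (sym (unit j)) ⟩
        c j * + lookup (v j) j               ≡⟨ sym (sumFin-single _ j others≡0) ⟩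
        lincomb c (λ i j → + lookup (v i) j) j ≡⟨ comb≡0 j ⟩
        + 0                                  ∎
        where open ≡-Reasoning
      -- The coordinate of a non-hole unit vector only occurs in its own unit hole.
      non-hole : ∀ j → 𝕖 j ∉ P → c j ≡ + 0
      non-hole j eⱼ∉P = isolated j λ i i≢j → term≡0 i j
        (decidable-stable (lookup (v i) j ℕ.≟ 0) λ vᵢⱼ≢0 → eⱼ∉P (others i j (i≢j ∘ sym) vᵢⱼ≢0))
      all-zero : ∀ j → c j ≡ + 0
      all-zero j = case-hole (𝕖 j ∈? P)
        where
        case-hole : Dec (𝕖 j ∈ P) → c j ≡ + 0
        case-hole (no  eⱼ∉P) = non-hole j eⱼ∉P
        case-hole (yes _)    = isolated j λ i i≢j → other i i≢j (𝕖 i ∈? P)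
          where
          other : ∀ i → i ≢ j → Dec (𝕖 i ∈ P) → c i * + lookup (v i) j ≡ + 0
          other i i≢j (yes eᵢ∈P) =
            term≡0 i j (trans (cong (λ x → lookup x j) (canonical i eᵢ∈P)) (lookup-𝕖-other (i≢j ∘ sym)))
          other i i≢j (no  eᵢ∉P) = cong (_* + lookup (v i) j) (non-hole i eᵢ∉P)

    fullSupport⇒dimSpan : DimSpan n P n
    fullSupport⇒dimSpan = (v , hole , v-linIndep) , λ k w _ → linIndep⇒≤ (λ i j → + lookup (w i) j)

    fullSupport⇒dim≤genus : n ≤ g
    fullSupport⇒dim≤genus = subst (n ≤_) genus (Fin.injective⇒≤ index-injective)
      where
      index-injective : ∀ {i j} → Any.index (hole i) ≡ Any.index (hole j) → i ≡ j
      index-injective {i} {j} idx≡ = v-injective (trans (Anyₚ.lookup-index (hole i))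
        (trans (cong (Data.List.lookup P) idx≡) (sym (Anyₚ.lookup-index (hole j)))))

-- Moving coordinates to the front

record Prefixing {d} (A : Fin d → Set) : Set where
  field
    size   : ℕ
    size≤d : size ≤ d
    perm   : Permutation′ d
    prefix : ∀ i → A (perm ⟨$⟩ʳ i) ⇔ toℕ i < size

insert-⟨$⟩ʳ-self : ∀ {m n} i j (π : Perm.Permutation m n) → Perm.insert i j π ⟨$⟩ʳ i ≡ j
insert-⟨$⟩ʳ-self i j π with i Fin.≟ i
... | yes _   = refl
... | no i≢i = contradiction refl i≢i

toℕ-punchIn-fromℕ : ∀ {d} (k : Fin d) → toℕ (punchIn (Fin.fromℕ d) k) ≡ toℕ k
toℕ-punchIn-fromℕ zero    = refl
toℕ-punchIn-fromℕ (suc k) = cong suc (toℕ-punchIn-fromℕ k)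

-- Coordinate 0 goes to the front if it is in A, and to the back otherwise.
prefixing : ∀ {d} {A : Fin d → Set} → Decidable A → Prefixing A
prefixing {zero} A? = record { size = 0 ; size≤d = z≤n ; perm = Perm.id ; prefix = λ () }
prefixing {suc d} {A} A? with prefixing (A? ∘ suc) | A? zero
... | record { size = n ; size≤d = n≤d ; perm = π ; prefix = prefix } | yes a₀ = record
  { size   = suc n
  ; size≤d = s≤s n≤d
  ; perm   = Perm.lift₀ π
  ; prefix = λ { zero → mk⇔ (λ _ → s≤s z≤n) (λ _ → a₀) ; (suc i) → ⇔.trans (prefix i) (mk⇔ s≤s ℕ.s≤s⁻¹) }
  }
... | record { size = n ; size≤d = n≤d ; perm = π ; prefix = prefix } | no ¬a₀ = record
  { size   = n
  ; size≤d = ℕ.m≤n⇒m≤1+n n≤d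
  ; perm   = π′
  ; prefix = λ i → at i (Fin.fromℕ d Fin.≟ i)
  }
  where
  π′ = Perm.insert (Fin.fromℕ d) zero π
  at : ∀ i → Dec (Fin.fromℕ d ≡ i) → A (π′ ⟨$⟩ʳ i) ⇔ toℕ i < n
  at i (yes refl) = mk⇔
    (λ a → contradiction (subst A (insert-⟨$⟩ʳ-self (Fin.fromℕ d) zero π) a) ¬a₀)
    (λ d<n → contradiction (subst (_< n) (Fin.toℕ-fromℕ d) d<n) (ℕ.≤⇒≯ n≤d))
  at i (no d≢i) = subst (λ i → A (π′ ⟨$⟩ʳ i) ⇔ toℕ i < n) (Fin.punchIn-punchOut d≢i)
    (subst₂ (λ x m → A x ⇔ m < n) (sym (Perm.insert-punchIn (Fin.fromℕ d) zero π k)) (sym (toℕ-punchIn-fromℕ k))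
      (prefix k))
    where k = punchOut d≢i

-- ℕ^n as the first n coordinates of ℕ^d.
module Prefix {n d : ℕ} .(n≤d : n ≤ d) where

  ι : Fin n → Fin d
  ι t = inject≤ t n≤d

  toℕ-ι : ∀ t → toℕ (ι t) ≡ toℕ t
  toℕ-ι t = Fin.toℕ-inject≤ t n≤d

  toℕ-ι< : ∀ t → toℕ (ι t) < n
  toℕ-ι< t = subst (_< n) (sym (toℕ-ι t)) (Fin.toℕ<n t)

  ι-injective : ∀ {s t} → ι s ≡ ι t → s ≡ t
  ι-injective {s} {t} = Fin.inject≤-injective n≤d n≤d s t

  prefix-view : ∀ i → (∃ λ t → ι t ≡ i) ⊎ n ≤ toℕ i
  prefix-view i with toℕ i ℕ.<? n
  ... | yes i<n = inj₁ (fromℕ< i<n , Fin.toℕ-injective (trans (toℕ-ι _) (Fin.toℕ-fromℕ< i<n)))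
  ... | no  i≮n = inj₂ (ℕ.≮⇒≥ i≮n)

  ι-not-beyond : ∀ t → ¬ n ≤ toℕ (ι t)
  ι-not-beyond t = ℕ.<⇒≱ (toℕ-ι< t)

  prefix-elim : ∀ {ℓ} (A : Fin d → Set ℓ) → (∀ t → A (ι t)) → (∀ i → n ≤ toℕ i → A i) → ∀ i → A i
  prefix-elim A below beyond i = [ (λ (t , ιt≡i) → subst A ιt≡i (below t)) , beyond i ]′ (prefix-view i)

  ≡-byPrefix : ∀ {x y : Pt d} → (∀ t → lookup x (ι t) ≡ lookup y (ι t)) →
    (∀ i → n ≤ toℕ i → lookup x i ≡ lookup y i) → x ≡ y
  ≡-byPrefix {x} {y} below beyond = lookup-ext (prefix-elim (λ i → lookup x i ≡ lookup y i) below beyond)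

  VanishesBeyond : Pt d → Set
  VanishesBeyond x = ∀ i → n ≤ toℕ i → lookup x i ≡ 0

  truncate : Pt d → Pt n
  truncate x = tabulate (lookup x ∘ ι)

  pad : Pt n → Pt d
  pad y = tabulate λ i → [ lookup y ∘ proj₁ , (λ _ → 0) ]′ (prefix-view i)

  lookup-truncate : ∀ x t → lookup (truncate x) t ≡ lookup x (ι t)
  lookup-truncate x t = Vec.lookup∘tabulate _ t

  lookup-pad-ι : ∀ y t → lookup (pad y) (ι t) ≡ lookup y t
  lookup-pad-ι y t = trans (Vec.lookup∘tabulate _ (ι t)) (at (prefix-view (ι t)))
    where
    at : (view : (∃ λ s → ι s ≡ ι t) ⊎ n ≤ toℕ (ι t)) → [ lookup y ∘ proj₁ , (λ _ → 0) ]′ view ≡ lookup y t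
    at (inj₁ (s , ιs≡ιt)) = cong (lookup y) (ι-injective ιs≡ιt)
    at (inj₂ n≤ιt)        = contradiction n≤ιt (ι-not-beyond t)

  pad-vanishes : ∀ y → VanishesBeyond (pad y)
  pad-vanishes y i n≤i = trans (Vec.lookup∘tabulate _ i) (at (prefix-view i))
    where
    at : (view : (∃ λ s → ι s ≡ i) ⊎ n ≤ toℕ i) → [ lookup y ∘ proj₁ , (λ _ → 0) ]′ view ≡ 0
    at (inj₁ (s , refl)) = contradiction n≤i (ι-not-beyond s)
    at (inj₂ _)          = refl

  truncate-pad : ∀ y → truncate (pad y) ≡ y
  truncate-pad y = lookup-ext λ t → trans (lookup-truncate (pad y) t) (lookup-pad-ι y t)

  pad-truncate : ∀ {x} → VanishesBeyond x → pad (truncate x) ≡ x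
  pad-truncate {x} x-vanishes = ≡-byPrefix
    (λ t → trans (lookup-pad-ι (truncate x) t) (lookup-truncate x t))
    (λ i n≤i → trans (pad-vanishes (truncate x) i n≤i) (sym (x-vanishes i n≤i)))

  pad-+ᵖ : ∀ x y → pad (x +ᵖ y) ≡ pad x +ᵖ pad y
  pad-+ᵖ x y = ≡-byPrefix
    (λ t → begin
      lookup (pad (x +ᵖ y)) (ι t)                   ≡⟨ lookup-pad-ι (x +ᵖ y) t ⟩
      lookup (x +ᵖ y) t                             ≡⟨ lookup-+ᵖ x y t ⟩
      lookup x t + lookup y t                       ≡⟨ sym (cong₂ _+_ (lookup-pad-ι x t) (lookup-pad-ι y t)) ⟩
      lookup (pad x) (ι t) + lookup (pad y) (ι t)   ≡⟨ sym (lookup-+ᵖ (pad x) (pad y) (ι t)) ⟩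
      lookup (pad x +ᵖ pad y) (ι t)                 ∎)
    (λ i n≤i → begin
      lookup (pad (x +ᵖ y)) i                       ≡⟨ pad-vanishes (x +ᵖ y) i n≤i ⟩
      0                                             ≡⟨ sym (cong₂ _+_ (pad-vanishes x i n≤i) (pad-vanishes y i n≤i)) ⟩
      lookup (pad x) i + lookup (pad y) i           ≡⟨ sym (lookup-+ᵖ (pad x) (pad y) i) ⟩
      lookup (pad x +ᵖ pad y) i                     ∎)
    where open ≡-Reasoning

  pad-0ᵖ : pad 0ᵖ ≡ 0ᵖ
  pad-0ᵖ = ≡-byPrefix (λ t → trans (lookup-pad-ι 0ᵖ t) (trans (lookup-0ᵖ t) (sym (lookup-0ᵖ (ι t)))))
                      (λ i n≤i → trans (pad-vanishes 0ᵖ i n≤i) (sym (lookup-0ᵖ i)))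

  truncate-+ᵖ : ∀ x y → truncate (x +ᵖ y) ≡ truncate x +ᵖ truncate y
  truncate-+ᵖ x y = lookup-ext λ t → begin
    lookup (truncate (x +ᵖ y)) t                      ≡⟨ lookup-truncate (x +ᵖ y) t ⟩
    lookup (x +ᵖ y) (ι t)                             ≡⟨ lookup-+ᵖ x y (ι t) ⟩
    lookup x (ι t) + lookup y (ι t)                   ≡⟨ sym (cong₂ _+_ (lookup-truncate x t) (lookup-truncate y t)) ⟩
    lookup (truncate x) t + lookup (truncate y) t     ≡⟨ sym (lookup-+ᵖ (truncate x) (truncate y) t) ⟩
    lookup (truncate x +ᵖ truncate y) t               ∎
    where open ≡-Reasoning

  truncate-0ᵖ : truncate 0ᵖ ≡ 0ᵖ
  truncate-0ᵖ = lookup-ext λ t → trans (lookup-truncate 0ᵖ t) (trans (lookup-0ᵖ (ι t)) (sym (lookup-0ᵖ t)))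

  VanishesBeyond-+ᵖ : ∀ x y → VanishesBeyond (x +ᵖ y) → VanishesBeyond x × VanishesBeyond y
  VanishesBeyond-+ᵖ x y x+y-vanishes =
    (λ i n≤i → ℕ.m+n≡0⇒m≡0 _ (trans (sym (lookup-+ᵖ x y i)) (x+y-vanishes i n≤i))) ,
    (λ i n≤i → ℕ.m+n≡0⇒n≡0 _ (trans (sym (lookup-+ᵖ x y i)) (x+y-vanishes i n≤i)))

  IsGNSHoles-truncate : ∀ {g} {H : List (Pt d)} → (∀ h → h ∈ H → VanishesBeyond h) →
    IsGNSHoles g d H → IsGNSHoles g n (map truncate H)
  IsGNSHoles-truncate H-vanishes = IsGNSHoles-transport truncate pad
    (λ h h∈H → pad-truncate (H-vanishes h h∈H)) (λ x y _ → truncate-pad x , truncate-pad y) pad-+ᵖ pad-0ᵖ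

  IsGNSHoles-pad : ∀ {g} {Q : List (Pt n)} → IsGNSHoles g n Q → IsGNSHoles g d (map pad Q)
  IsGNSHoles-pad = IsGNSHoles-transport pad truncate (λ y _ → truncate-pad y)
    (λ x y x+y∈padQ →
      let (z , _ , x+y≡pz) = ∈.∈-map⁻ pad x+y∈padQ
          (x-vanishes , y-vanishes) = VanishesBeyond-+ᵖ x y (subst VanishesBeyond (sym x+y≡pz) (pad-vanishes z))
      in pad-truncate x-vanishes , pad-truncate y-vanishes)
    truncate-+ᵖ truncate-0ᵖ

  map-pad∘truncate : ∀ {H : List (Pt d)} → (∀ h → h ∈ H → VanishesBeyond h) → map pad (map truncate H) ≡ H
  map-pad∘truncate {H} H-vanishes =
    trans (sym (List.map-∘ H)) (List.map-id-local (All.tabulate λ {h} h∈H → pad-truncate (H-vanishes h h∈H)))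

  ∈-map-pad : ∀ {Q : List (Pt n)} y → y ∈ Q ⇔ pad y ∈ map pad Q
  ∈-map-pad {Q} y = mk⇔ (∈.∈-map⁺ pad) λ py∈padQ →
    let (z , z∈Q , py≡pz) = ∈.∈-map⁻ pad py∈padQ in
    subst (_∈ Q) (trans (sym (truncate-pad z)) (trans (cong truncate (sym py≡pz)) (truncate-pad y))) z∈Q

  InSupport-pad : ∀ {Q : List (Pt n)} → FullSupport Q → ∀ i → InSupport (map pad Q) i ⇔ toℕ i < n
  InSupport-pad {Q} Q-full i = mk⇔
    (λ (x , x∈padQ , xᵢ≢0) → ℕ.≰⇒> λ n≤i →
      let (y , _ , x≡py) = ∈.∈-map⁻ pad x∈padQ in
      xᵢ≢0 (trans (cong (λ z → lookup z i) x≡py) (pad-vanishes y i n≤i)))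
    (λ i<n → [ (λ (t , ιt≡i) → subst (InSupport (map pad Q)) ιt≡i (in-support t))
             , (λ n≤i → contradiction i<n (ℕ.≤⇒≯ n≤i)) ]′ (prefix-view i))
    where
    in-support : ∀ t → InSupport (map pad Q) (ι t)
    in-support t = let (y , y∈Q , yₜ≢0) = Q-full t in
      pad y , ∈.∈-map⁺ pad y∈Q , λ pyₜ≡0 → yₜ≢0 (trans (sym (lookup-pad-ι y t)) pyₜ≡0)

  FullSupport-truncate : ∀ {H : List (Pt d)} → (∀ t → InSupport H (ι t)) → FullSupport (map truncate H)
  FullSupport-truncate H-covers t = let (h , h∈H , hₜ≢0) = H-covers t in
    truncate h , ∈.∈-map⁺ truncate h∈H , λ hₜ≡0 → hₜ≢0 (trans (sym (lookup-truncate h t)) hₜ≡0)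

  InSupport⇒VanishesBeyond : ∀ {H : List (Pt d)} → (∀ i → InSupport H i → toℕ i < n) →
    ∀ h → h ∈ H → VanishesBeyond h
  InSupport⇒VanishesBeyond support⊆ h h∈H i n≤i =
    decidable-stable (lookup h i ℕ.≟ 0) λ hᵢ≢0 → ℕ.≤⇒≯ n≤i (support⊆ i (h , h∈H , hᵢ≢0))

  record Extends (σ : Permutation′ d) (τ : Permutation′ n) : Set where
    field
      on-prefix  : ∀ t → σ ⟨$⟩ʳ ι t ≡ ι (τ ⟨$⟩ʳ t)
      off-prefix : ∀ i → n ≤ toℕ i → n ≤ toℕ (σ ⟨$⟩ʳ i)

  module _ {σ : Permutation′ d} {τ : Permutation′ n} (σ-extends-τ : Extends σ τ) where
    open Extends σ-extends-τ

    permute-pad : ∀ y → permute σ (pad y) ≡ pad (permute τ y)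
    permute-pad y = ≡-byPrefix
      (λ t → begin
        lookup (permute σ (pad y)) (ι t)   ≡⟨ lookup-permute σ (pad y) (ι t) ⟩
        lookup (pad y) (σ ⟨$⟩ʳ ι t)        ≡⟨ cong (lookup (pad y)) (on-prefix t) ⟩
        lookup (pad y) (ι (τ ⟨$⟩ʳ t))      ≡⟨ lookup-pad-ι y _ ⟩
        lookup y (τ ⟨$⟩ʳ t)                ≡⟨ sym (lookup-permute τ y t) ⟩
        lookup (permute τ y) t             ≡⟨ sym (lookup-pad-ι (permute τ y) t) ⟩
        lookup (pad (permute τ y)) (ι t)   ∎)
      (λ i n≤i → trans (lookup-permute σ (pad y) i)
        (trans (pad-vanishes y _ (off-prefix i n≤i)) (sym (pad-vanishes (permute τ y) i n≤i))))
      where open ≡-Reasoning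

    ≅-pad : ∀ {P Q} → P ≅[ τ ] Q → map pad P ≅[ σ ] map pad Q
    ≅-pad {P} {Q} P≅Q x = mk⇔
      (λ x∈padP → let (y , y∈P , x≡py) = ∈.∈-map⁻ pad x∈padP in
        subst (_∈ map pad Q) (sym (trans (cong (permute σ) x≡py) (permute-pad y))) (∈.∈-map⁺ pad (to (P≅Q y) y∈P)))
      (λ σx∈padQ → let (z , z∈Q , σx≡pz) = ∈.∈-map⁻ pad σx∈padQ
                       y = permute (flip τ) z in
        subst (_∈ map pad P)
          (permute-injective σ (trans (permute-pad y) (trans (cong pad (permute-inverseʳ τ z)) (sym σx≡pz))))
          (∈.∈-map⁺ pad (from (P≅Q y) (subst (_∈ Q) (sym (permute-inverseʳ τ z)) z∈Q))))

    ≅-pad⁻ : ∀ {P Q} → map pad P ≅[ σ ] map pad Q → P ≅[ τ ] Q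
    ≅-pad⁻ {P} {Q} padP≅padQ y = begin
      y ∈ P                              ≈⟨ ∈-map-pad y ⟩
      pad y ∈ map pad P                  ≈⟨ padP≅padQ (pad y) ⟩
      permute σ (pad y) ∈ map pad Q      ≡⟨ cong (_∈ map pad Q) (permute-pad y) ⟩
      pad (permute τ y) ∈ map pad Q      ≈⟨ ⇔.sym (∈-map-pad (permute τ y)) ⟩
      permute τ y ∈ Q                    ∎
      where open import Relation.Binary.Reasoning.Setoid (⇔.⇔-setoid 0ℓ)

  extendF : Permutation′ n → Fin d → Fin d
  extendF τ i = [ (λ (t , _) → ι (τ ⟨$⟩ʳ t)) , (λ _ → i) ]′ (prefix-view i)

  extendF-ι : ∀ τ t → extendF τ (ι t) ≡ ι (τ ⟨$⟩ʳ t)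
  extendF-ι τ t with prefix-view (ι t)
  ... | inj₁ (s , ιs≡ιt) = cong (λ s → ι (τ ⟨$⟩ʳ s)) (ι-injective ιs≡ιt)
  ... | inj₂ n≤ιt        = contradiction n≤ιt (ι-not-beyond t)

  extendF-beyond : ∀ τ {i} → n ≤ toℕ i → extendF τ i ≡ i
  extendF-beyond τ {i} n≤i with prefix-view i
  ... | inj₁ (s , refl) = contradiction n≤i (ι-not-beyond s)
  ... | inj₂ _          = refl

  extendF-inverse : ∀ τ ρ → (∀ t → τ ⟨$⟩ʳ (ρ ⟨$⟩ʳ t) ≡ t) → ∀ i → extendF τ (extendF ρ i) ≡ i
  extendF-inverse τ ρ inverse = prefix-elim (λ i → extendF τ (extendF ρ i) ≡ i)
    (λ t → trans (cong (extendF τ) (extendF-ι ρ t)) (trans (extendF-ι τ _) (cong ι (inverse t))))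
    (λ i n≤i → trans (cong (extendF τ) (extendF-beyond ρ n≤i)) (extendF-beyond τ n≤i))

  extend : Permutation′ n → Permutation′ d
  extend τ = Perm.permutation (extendF τ) (extendF (flip τ))
    (extendF-inverse τ (flip τ) (λ _ → inverseʳ τ)) (extendF-inverse (flip τ) τ (λ _ → inverseˡ τ))

  extend-extends : ∀ τ → Extends (extend τ) τ
  extend-extends τ = record
    { on-prefix  = extendF-ι τ
    ; off-prefix = λ i n≤i → subst (λ j → n ≤ toℕ j) (sym (extendF-beyond τ n≤i)) n≤i
    }

  PreservesPrefix : Permutation′ d → Set
  PreservesPrefix σ = ∀ i → toℕ i < n ⇔ toℕ (σ ⟨$⟩ʳ i) < n

  PreservesPrefix-flip : ∀ σ → PreservesPrefix σ → PreservesPrefix (flip σ)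
  PreservesPrefix-flip σ preserves i =
    ⇔.sym (subst (λ j → toℕ (flip σ ⟨$⟩ʳ i) < n ⇔ toℕ j < n) (inverseʳ σ) (preserves (flip σ ⟨$⟩ʳ i)))

  restrictF : ∀ σ → PreservesPrefix σ → Fin n → Fin n
  restrictF σ preserves t = fromℕ< (to (preserves (ι t)) (toℕ-ι< t))

  ι-restrictF : ∀ σ preserves t → ι (restrictF σ preserves t) ≡ σ ⟨$⟩ʳ ι t
  ι-restrictF σ preserves t = Fin.toℕ-injective (trans (toℕ-ι _) (Fin.toℕ-fromℕ< _))

  restrictF-inverse : ∀ σ ρ p q → (∀ i → σ ⟨$⟩ʳ (ρ ⟨$⟩ʳ i) ≡ i) → ∀ t → restrictF σ p (restrictF ρ q t) ≡ t
  restrictF-inverse σ ρ p q inverse t = ι-injective (begin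
    ι (restrictF σ p (restrictF ρ q t))   ≡⟨ ι-restrictF σ p _ ⟩
    σ ⟨$⟩ʳ ι (restrictF ρ q t)            ≡⟨ cong (σ ⟨$⟩ʳ_) (ι-restrictF ρ q t) ⟩
    σ ⟨$⟩ʳ (ρ ⟨$⟩ʳ ι t)                   ≡⟨ inverse (ι t) ⟩
    ι t                                   ∎)
    where open ≡-Reasoning

  restrict : ∀ σ → PreservesPrefix σ → Permutation′ n
  restrict σ preserves = Perm.permutation (restrictF σ preserves) (restrictF (flip σ) preserves⁻¹)
    (restrictF-inverse σ (flip σ) preserves preserves⁻¹ (λ _ → inverseʳ σ))
    (restrictF-inverse (flip σ) σ preserves⁻¹ preserves (λ _ → inverseˡ σ))
    where preserves⁻¹ = PreservesPrefix-flip σ preserves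

  restrict-extends : ∀ σ preserves → Extends σ (restrict σ preserves)
  restrict-extends σ preserves = record
    { on-prefix  = λ t → sym (ι-restrictF σ preserves t)
    ; off-prefix = λ i n≤i → ℕ.≮⇒≥ λ σi<n → ℕ.≤⇒≯ n≤i (from (preserves i) σi<n)
    }

prefix-≤ : ∀ {m n d} (σ : Permutation′ d) → m ≤ d → (∀ i → toℕ i < m → toℕ (σ ⟨$⟩ʳ i) < n) → m ≤ n
prefix-≤ {m} {n} σ m≤d into = Fin.injective⇒≤ {f = f} f-injective
  where
  open Prefix m≤d using (ι; toℕ-ι<; ι-injective)
  f : Fin m → Fin n
  f t = fromℕ< (into (ι t) (toℕ-ι< t))
  f-injective : ∀ {s t} → f s ≡ f t → s ≡ t
  f-injective fs≡ft = ι-injective (⟨$⟩ʳ-injective σ (Fin.toℕ-injective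
    (trans (sym (Fin.toℕ-fromℕ< _)) (trans (cong toℕ fs≡ft) (Fin.toℕ-fromℕ< _)))))

prefix-size-unique : ∀ {m n d} (σ : Permutation′ d) → m ≤ d → n ≤ d →
  (∀ i → toℕ i < m ⇔ toℕ (σ ⟨$⟩ʳ i) < n) → m ≡ n
prefix-size-unique {m} {n} σ m≤d n≤d m⇔n = ℕ.≤-antisym
  (prefix-≤ σ m≤d (to ∘ m⇔n))
  (prefix-≤ (flip σ) n≤d λ i i<n →
    from (m⇔n (flip σ ⟨$⟩ʳ i)) (subst (_< n) (sym (cong toℕ (inverseʳ σ))) i<n))

-- Reduction to hole sets using every coordinate

Iso-pad : ∀ {n m d} (n≤d : n ≤ d) (m≤d : m ≤ d) {P : List (Pt n)} {Q : List (Pt m)} →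
  Fibrewise Iso (n , P) (m , Q) → Iso d (map (Prefix.pad n≤d) P) (map (Prefix.pad m≤d) Q)
Iso-pad n≤d m≤d (fibrewise (τ , P≅Q)) = extend τ , ≅-pad (extend-extends τ) P≅Q
  where open Prefix n≤d

Iso-pad⇒prefix⇔ : ∀ {n m d} (n≤d : n ≤ d) (m≤d : m ≤ d) {P : List (Pt n)} {Q : List (Pt m)} σ →
  FullSupport P → FullSupport Q → map (Prefix.pad n≤d) P ≅[ σ ] map (Prefix.pad m≤d) Q →
  ∀ i → toℕ i < m ⇔ toℕ (σ ⟨$⟩ʳ i) < n
Iso-pad⇒prefix⇔ n≤d m≤d σ P-full Q-full padP≅padQ i =
  ⇔.trans (⇔.sym (Prefix.InSupport-pad m≤d Q-full i))
    (⇔.trans (InSupport-≅ σ padP≅padQ i) (Prefix.InSupport-pad n≤d P-full (σ ⟨$⟩ʳ i)))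

Iso-pad⁻ : ∀ {n m d} (n≤d : n ≤ d) (m≤d : m ≤ d) {P : List (Pt n)} {Q : List (Pt m)} →
  FullSupport P → FullSupport Q → Iso d (map (Prefix.pad n≤d) P) (map (Prefix.pad m≤d) Q) →
  Fibrewise Iso (n , P) (m , Q)
Iso-pad⁻ n≤d m≤d P-full Q-full (σ , padP≅padQ)
  with prefix-size-unique σ m≤d n≤d (Iso-pad⇒prefix⇔ n≤d m≤d σ P-full Q-full padP≅padQ)
... | refl = fibrewise (restrict σ preserves , ≅-pad⁻ (restrict-extends σ preserves) padP≅padQ)
  where
  open Prefix n≤d
  preserves = Iso-pad⇒prefix⇔ n≤d m≤d σ P-full Q-full padP≅padQ

record Reduction {d} (H : List (Pt d)) : Set where
  field
    dim         : ℕ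
    dim≤d       : dim ≤ d
    holes       : List (Pt dim)
    fullSupport : FullSupport holes
    iso         : Iso d H (map (Prefix.pad dim≤d) holes)
    isGNS       : ∀ {g} → IsGNSHoles g d H → IsGNSHoles g dim holes

reduce : ∀ {d} (H : List (Pt d)) → Reduction H
reduce {d} H = record
  { dim         = n
  ; dim≤d       = n≤d
  ; holes       = map truncate H′
  ; fullSupport = FullSupport-truncate λ t → from (support⇔prefix (ι t)) (toℕ-ι< t)
  ; iso         = π , subst (H ≅[ π ]_) (sym (map-pad∘truncate H′-vanishes)) (≅-map π H)
  ; isGNS       = IsGNSHoles-truncate H′-vanishes ∘ IsGNSHoles-permute π
  }
  where
  open Prefixing (prefixing (InSupport? H)) renaming (size to n; size≤d to n≤d; perm to π)
  open Prefix n≤d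
  H′ = map (permute π) H
  support⇔prefix : ∀ i → InSupport H′ i ⇔ toℕ i < n
  support⇔prefix i = ⇔.trans (InSupport-≅ π (≅-map π H) i) (prefix i)
  H′-vanishes : ∀ h → h ∈ H′ → VanishesBeyond h
  H′-vanishes = InSupport⇒VanishesBeyond (to ∘ support⇔prefix)

reduced : ∀ {d} → List (Pt d) → Σ ℕ (List ∘ Pt)
reduced H = Reduction.dim (reduce H) , Reduction.holes (reduce H)

module _ {d : ℕ} where
  open Reduction

  reduced-cong : ∀ {H H′ : List (Pt d)} → Iso d H H′ → Fibrewise Iso (reduced H) (reduced H′)
  reduced-cong {H} {H′} H≅H′ = Iso-pad⁻ (dim≤d (reduce H)) (dim≤d (reduce H′))
    (fullSupport (reduce H)) (fullSupport (reduce H′))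
    (Iso-trans (Iso-sym (iso (reduce H))) (Iso-trans H≅H′ (iso (reduce H′))))

  reduced-reflects : ∀ {H H′ : List (Pt d)} → Fibrewise Iso (reduced H) (reduced H′) → Iso d H H′
  reduced-reflects {H} {H′} reduced≅ = Iso-trans (iso (reduce H))
    (Iso-trans (Iso-pad (dim≤d (reduce H)) (dim≤d (reduce H′)) reduced≅) (Iso-sym (iso (reduce H′))))

  reduced-pad : ∀ {n} (n≤d : n ≤ d) {Q : List (Pt n)} → FullSupport Q →
    Fibrewise Iso (reduced (map (Prefix.pad n≤d) Q)) (n , Q)
  reduced-pad n≤d {Q} Q-full =
    Iso-pad⁻ (dim≤d (reduce H)) n≤d (fullSupport (reduce H)) Q-full (Iso-sym (iso (reduce H)))
    where H = map (Prefix.pad n≤d) Q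

-- Classes of GNSs

∈-applyUpTo-suc : ∀ {n q} → n ∈ applyUpTo suc q ⇔ (1 ≤ n × n ≤ q)
∈-applyUpTo-suc {q = q} = mk⇔
  (λ n∈ → let (k , k<q , n≡1+k) = ∈.∈-applyUpTo⁻ suc n∈ in
    subst (λ n → 1 ≤ n × n ≤ q) (sym n≡1+k) (s≤s z≤n , k<q))
  (λ { (s≤s z≤n , n≤q) → ∈.∈-applyUpTo⁺ suc n≤q })

applyUpTo-suc-unique : ∀ q → Unique (applyUpTo suc q)
applyUpTo-suc-unique q = Unique.applyUpTo⁺₁ suc q λ i<j _ → ℕ.<⇒≢ (s≤s i<j)

module _ (g d : ℕ) (1≤g : 1 ≤ g) where

  Spanning : ∀ n → List (Pt n) → Set
  Spanning n H = IsGNSHoles g n H × DimSpan n H n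

  Reduced : Σ ℕ (List ∘ Pt) → Set
  Reduced = Over Spanning (_∈ applyUpTo suc (g ⊓ d))

  reduced-Reduced : ∀ {H} → IsGNSHoles g d H → Reduced (reduced H)
  reduced-Reduced {H} gns =
    from ∈-applyUpTo-suc (IsGNSHoles-dim>0 1≤g gns′ , ℕ.⊓-glb (fullSupport⇒dim≤genus fullSupport) dim≤d) ,
    gns′ , fullSupport⇒dimSpan fullSupport
    where
    open Reduction (reduce H)
    gns′ = isGNS gns
    open UnitHoles gns′

  reduction : ClassCorrespondence (IsGNSHoles g d) (Iso d) Reduced (Fibrewise Iso)
  reduction = record
    { f          = reduced
    ; preserves  = reduced-Reduced
    ; f-cong     = λ _ _ → reduced-cong
    ; reflects   = λ _ _ → reduced-reflects
    ; surjective = λ { {n , Q} (n∈ , gnsQ , dimSpanQ) →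
        let n≤d = ℕ.≤-trans (proj₂ (to ∈-applyUpTo-suc n∈)) (ℕ.m⊓n≤n g d) in
        map (Prefix.pad n≤d) Q , Prefix.IsGNSHoles-pad n≤d gnsQ , reduced-pad n≤d (dimSpan⇒fullSupport dimSpanQ) }
    }

mainTheorem14 : ∀ (g d : ℕ) → 1 ≤ g → 1 ≤ d →
    ∀ (N : ℕ) (Nr : ℕ → ℕ) →
    ClassCount (IsGNSHoles g d) (Iso d) N →
    (∀ n → 1 ≤ n → n ≤ g ⊓ d →
      ClassCount (λ H → IsGNSHoles g n H × DimSpan n H n) (Iso n) (Nr n)) →
    N ≡ sum (map Nr (applyUpTo suc (g ⊓ d)))
mainTheorem14 g d 1≤g _ N Nr ccD ccN = ClassCount-unique Fibrewise-Iso-isEquivalence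
  (ClassCount-correspondence Fibrewise-Iso-isEquivalence (reduction g d 1≤g) ccD)
  (ClassCount-Σ (λ _ → Iso-isEquivalence) Nr (applyUpTo suc (g ⊓ d)) (applyUpTo-suc-unique (g ⊓ d))
    λ n n∈ → uncurry (ccN n) (to ∈-applyUpTo-suc n∈))
  where
  Fibrewise-Iso-isEquivalence = Fibrewise-isEquivalence λ _ → Iso-isEquivalence
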